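{- Let $I$ be a combinatorial chamber and $W$ a wall satisfying: (1) $I=I(W|facet)\cup I(W|cut)$; (2) $I(W|facet)\ne\emptyset$; (3) for each $\nu\in\mathcal{W}$ spanning $W$, if $\delta^+(\nu)\cap I\ne\emptyset$ then $\delta^+(\nu)\subseteq I$ and $\delta^-(\nu)\cap I=\emptyset$, and if $\delta^-(\nu)\cap I\ne\emptyset$ then $\delta^-(\nu)\subseteq I$ and $\delta^+(\nu)\cap I=\emptyset$; but not (4), i.e. $I(W|cut)\ne\emptyset$ and $\bigcap_{\sigma\in I(W|cut)}\mathrm{int}\,C(\sigma)$ does not intersect $W$ in an $(r-1)$-dimensional set. Then $reflexion(I,W)$ is not a feasible subset of $\mathcal{B}$.
   Context: $\Delta^+=\{\phi_1,\dots,\phi_N\}$ are distinct nonzero vectors spanning $\mathbb{R}^r$ generating a pointed cone. $\mathcal{B}$ is the set of basic subsets $\sigma$ ($|\sigma|=r$, $\{\phi_i\}_{i\in\sigma}$ independent), $C(\sigma)$ the closed cone generated; for $I\subseteq\mathcal{B}$, $F(I)=\bigcap_{\sigma\in I}C(\sigma)$, and $I$ is feasible if $F(I)$ has nonempty interior; a combinatorial chamber is a maximal feasible subset. A wall is a hyperplane spanned by $r-1$ independent $\phi_i$, partitioning indices into $zeros(W)$, $pos(W)$, $neg(W)$ (the two open sides). $\mathcal{W}$: sets $\nu$ of $r-1$ indices with independent vectors; for $\nu$ spanning $W$, $\delta^+(\nu)=\{\nu\cup\{i\}:i\in pos(W)\}$, $\delta^-(\nu)=\{\nu\cup\{i\}:i\in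 neg(W)\}$. $I(W|facet)=\{\sigma\in I:|\sigma\cap zeros(W)|=r-1\}$, $I(W|cut)=\{\sigma\in I:\sigma\cap pos(W)\ne\emptyset\ne\sigma\cap neg(W)\}$, $B(W,I)=\{\sigma\cap zeros(W):\sigma\in I(W|facet)\}$. $reflexion(I,W)$ consists of $I(W|cut)$ together with, for each $\nu\in B(W,I)$, the set among $\delta^+(\nu),\delta^-(\nu)$ that is disjoint from $I$ (i.e. each $\delta^\pm(\nu)\subseteq I(W|facet)$ is replaced by its opposite $\delta^\mp(\nu)$). -}

module Defs where

open import Level using (0ℓ)
open import Data.Nat using (ℕ; zero; suc; _∸_)
open import Data.Fin using (Fin; zero; suc)
open import Data.Fin.Subset using (Subset; ⊤; _∈_; _∉_; _∪_; ⁅_⁆; ∣_∣)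
open import Data.Product using (Σ; ∃; ∃-syntax; _×_; _,_)
open import Data.Sum using (_⊎_)
open import Data.Empty using (⊥)
open import Relation.Nullary using (¬_)
open import Relation.Binary.PropositionalEquality using (_≡_; _≢_)
open import Relation.Binary.Structures using (IsStrictTotalOrder)
open import Algebra.Structures using (IsCommutativeRing)
open import Function.Bundles using (_⇔_)

-- An ordered field (with propositional equality).  ℝ is an instance;
-- the statement is made for every ordered field.

record OrderedField : Set₁ where
  infixl 6 _+_
  infixl 7 _*_
  infix  8 -_
  infix  4 _<_
  field
    Carrier   : Set
    _+_ _*_   : Carrier → Carrier → Carrier
    -_        : Carrier → Carrier
    0# 1#     : Carrier
    _<_       : Carrier → Carrier → Set
    isCommutativeRing : IsCommutativeRing _≡_ _+_ _*_ -_ 0# 1#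
    0≢1       : 0# ≢ 1#
    inverse   : ∀ x → x ≢ 0# → ∃[ y ] (x * y ≡ 1#)
    isStrictTotalOrder : IsStrictTotalOrder _≡_ _<_
    +-mono-<  : ∀ {x y} z → x < y → x + z < y + z
    *-pos     : ∀ {x y} → 0# < x → 0# < y → 0# < x * y

  _-_ : Carrier → Carrier → Carrier
  x - y = x + (- y)

  _≤_ : Carrier → Carrier → Set
  x ≤ y = (x < y) ⊎ (x ≡ y)

-- Linear-algebraic / cone-theoretic setting of the paper, for a fixed
-- ordered field K and a family Δ⁺ = (φ₁,…,φ_N) of vectors in K^r.

module Geometry (K : OrderedField) (r N : ℕ) (φ : Fin N → Fin r → OrderedField.Carrier K) where
  open OrderedField K

  Vect : Set
  Vect = Fin r → Carrier

  sumF : ∀ {n} → (Fin n → Carrier) → Carrier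
  sumF {zero}  f = 0#
  sumF {suc n} f = f zero + sumF (λ i → f (suc i))

  comb : (Fin N → Carrier) → Vect
  comb c j = sumF (λ i → c i * φ i j)

  _≈v_ : Vect → Vect → Set
  x ≈v y = ∀ j → x j ≡ y j

  0v : Vect
  0v j = 0#

  -v_ : Vect → Vect
  (-v x) j = - x j

  dot : Vect → Vect → Carrier
  dot x y = sumF (λ j → x j * y j)

  SupportedOn : Subset N → (Fin N → Carrier) → Set
  SupportedOn σ c = ∀ i → i ∉ σ → c i ≡ 0#

  Independent : Subset N → Set
  Independent σ = ∀ c → SupportedOn σ c → comb c ≈v 0v → ∀ i → c i ≡ 0#

  InSpan : Subset N → Vect → Set
  InSpan ν x = ∃[ c ] (SupportedOn ν c × comb c ≈v x)

  InCone : Subset N → Vect → Set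
  InCone σ x = ∃[ c ] (SupportedOn σ c × (∀ i → i ∈ σ → 0# ≤ c i) × comb c ≈v x)

  Interior : (Vect → Set) → Vect → Set
  Interior S x = ∃[ ε ] (0# < ε × (∀ y → (∀ j → (x j - ε < y j) × (y j < x j + ε)) → S y))

  Distinct : Set
  Distinct = ∀ i k → φ i ≈v φ k → i ≡ k

  NonzeroVectors : Set
  NonzeroVectors = ∀ i → ¬ (φ i ≈v 0v)

  Everything : Subset N
  Everything = ⊤

  Spanning : Set
  Spanning = ∀ x → InSpan Everything x

  Pointed : Set
  Pointed = ∀ x → InCone Everything x → InCone Everything (-v x) → x ≈v 0v

  Basic : Subset N → Set
  Basic σ = (∣ σ ∣ ≡ r) × Independent σ

  SetOfSubsets : Set₁
  SetOfSubsets = Subset N → Set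

  _⊆B_ : SetOfSubsets → SetOfSubsets → Set
  I ⊆B J = ∀ σ → I σ → J σ

  InB : SetOfSubsets → Set
  InB I = ∀ σ → I σ → Basic σ

  F : SetOfSubsets → Vect → Set
  F I x = ∀ σ → I σ → InCone σ x

  Feasible : SetOfSubsets → Set
  Feasible I = ∃[ x ] Interior (F I) x

  Chamber : SetOfSubsets → Set₁
  Chamber I = InB I × Feasible I × (∀ J → InB J → Feasible J → I ⊆B J → J ⊆B I)

  -- walls.  A wall W is represented by a linear functional w with
  -- W = ker w; the choice of w fixes which open side is "pos".

  Zero Pos Neg : Vect → Fin N → Set
  Zero w i = dot w (φ i) ≡ 0#
  Pos  w i = 0# < dot w (φ i)
  Neg  w i = dot w (φ i) < 0#

  SpansWall : Vect → Subset N → Set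
  SpansWall w ν = (∣ ν ∣ ≡ r ∸ 1) × Independent ν × (∀ x → (dot w x ≡ 0#) ⇔ InSpan ν x)

  IsWall : Vect → Set
  IsWall w = ∃[ ν ] SpansWall w ν

  δ⁺ δ⁻ : Vect → Subset N → Subset N → Set
  δ⁺ w ν σ = ∃[ i ] (Pos w i × σ ≡ ν ∪ ⁅ i ⁆)
  δ⁻ w ν σ = ∃[ i ] (Neg w i × σ ≡ ν ∪ ⁅ i ⁆)

  IsZeroPart : Vect → Subset N → Subset N → Set
  IsZeroPart w σ τ = ∀ i → (i ∈ τ) ⇔ ((i ∈ σ) × Zero w i)

  Facet : SetOfSubsets → Vect → SetOfSubsets
  Facet I w σ = I σ × ∃[ τ ] (IsZeroPart w σ τ × ∣ τ ∣ ≡ r ∸ 1)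

  Cut : SetOfSubsets → Vect → SetOfSubsets
  Cut I w σ = I σ × (∃[ i ] (i ∈ σ × Pos w i)) × (∃[ k ] (k ∈ σ × Neg w k))

  BW : SetOfSubsets → Vect → SetOfSubsets
  BW I w ν = ∃[ σ ] (Facet I w σ × IsZeroPart w σ ν)

  Meets Disjoint _⊆S_ : SetOfSubsets → SetOfSubsets → Set
  Meets A B = ∃[ σ ] (A σ × B σ)
  Disjoint A B = ¬ Meets A B
  A ⊆S B = A ⊆B B

  reflexion : SetOfSubsets → Vect → SetOfSubsets
  reflexion I w σ =
    Cut I w σ ⊎
    (∃[ ν ] (BW I w ν × ((δ⁺ w ν σ × Disjoint (δ⁺ w ν) I) ⊎ (δ⁻ w ν σ × Disjoint (δ⁻ w ν) I))))

  Cond1 : SetOfSubsets → Vect → Set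
  Cond1 I w = ∀ σ → I σ → Facet I w σ ⊎ Cut I w σ

  Cond2 : SetOfSubsets → Vect → Set
  Cond2 I w = ∃[ σ ] Facet I w σ

  Cond3 : SetOfSubsets → Vect → Set
  Cond3 I w = ∀ ν → SpansWall w ν →
      (Meets (δ⁺ w ν) I → (δ⁺ w ν ⊆S I) × Disjoint (δ⁻ w ν) I)
    × (Meets (δ⁻ w ν) I → (δ⁻ w ν ⊆S I) × Disjoint (δ⁺ w ν) I)

  -- negation of (4): I(W|cut) ≠ ∅ and ⋂_{σ∈I(W|cut)} int C(σ) does not
  -- meet W (for an open convex set, meeting the
  -- hyperplane W is the same as meeting it in an (r-1)-dim set)
  NotCond4 : SetOfSubsets → Vect → Set
  NotCond4 I w = (∃[ σ ] Cut I w σ)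
    × ¬ (∃[ x ] ((dot w x ≡ 0#) × (∀ σ → Cut I w σ → Interior (InCone σ) x)))

{-# OPTIONS --safe #-}
module Submission where

-- Let x and y be interior points of F(I) and of F(reflexion(I,W)). Every σ ∈ I(W|cut) lies in
-- both I and reflexion(I,W), so x and y are interior points of every cut cone C(σ), and so is
-- x + t y for t ≥ 0 because int C + C ⊆ int C. Choosing t to land on W, the failure of (4)
-- shows that x and y cannot lie on opposite closed sides of W.
-- A facet σ ∈ I has r - 1 generators on W, so its generators, and with them x ∈ C(σ), lie on one
-- closed side of W, say the positive one. The cones of δ⁻(σ ∩ W) lie on the closed negative side,
-- so none of them belongs to I, and reflexion(I,W) contains all of δ⁻(σ ∩ W). This set is nonempty,
-- since a cut cone has a generator on the negative side, and y lies in one of its cones, hence on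
-- the closed negative side: a contradiction.

open import Defs
open import Data.Nat using (ℕ)
import Data.Nat as ℕ
open import Data.Nat.Properties using (≤-trans; <-irrefl; m≤n+m∸n)
open import Data.Fin using (Fin; zero; suc)
open import Data.Fin.Properties using (any?)
open import Data.Fin.Subset using (Subset; _∈_; _∉_; _⊆_; _⊂_; _∪_; ⁅_⁆; ∣_∣)
import Data.Fin.Subset as Subset
open import Data.Fin.Subset.Properties
  using (_∈?_; x∈p∪q⁻; x∈⁅y⁆⇒x≡y; x∈p∧x≢y⇒x∈p-y; x∈p⇒∣p-x∣<∣p∣; p⊂q⇒∣p∣<∣q∣)
open import Data.Product using (∃-syntax; _×_; _,_; proj₁; proj₂)
open import Data.Sum using (inj₁; inj₂)
open import Data.Empty using (⊥-elim)
open import Function using (_∘_; flip)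
open import Function.Bundles using (Equivalence)
open import Relation.Nullary using (¬_; yes; no; _×-dec_)
open import Relation.Binary.PropositionalEquality
  using (_≡_; _≢_; refl; sym; trans; cong; cong₂; subst; subst₂; module ≡-Reasoning)
open import Relation.Binary.Definitions using (tri<; tri≈; tri>)
open import Relation.Binary.Structures using (IsStrictTotalOrder)
open import Level using (0ℓ)
open import Algebra.Bundles using (CommutativeRing)
import Algebra.Properties.Ring as RingProperties
import Algebra.Properties.CommutativeSemigroup as CommutativeSemigroupProperties
import Algebra.Properties.Semiring.Sum as SemiringSum

two∈q∖p⇒2+∣p∣≤∣q∣ : ∀ {n} {p q : Subset n} {x y} → p ⊆ q → x ∈ q → y ∈ q → x ≢ y → x ∉ p → y ∉ p →
                    ℕ.suc (ℕ.suc ∣ p ∣) ℕ.≤ ∣ q ∣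
two∈q∖p⇒2+∣p∣≤∣q∣ {p = p} {q} {x} {y} p⊆q x∈q y∈q x≢y x∉p y∉p =
  ≤-trans (ℕ.s≤s (p⊂q⇒∣p∣<∣q∣ p⊂q-y)) (x∈p⇒∣p-x∣<∣p∣ y∈q)
  where
  p⊂q-y : p ⊂ q Subset.- y
  p⊂q-y = (λ z∈p → x∈p∧x≢y⇒x∈p-y (p⊆q z∈p) (λ { refl → y∉p z∈p }))
        , x , x∈p∧x≢y⇒x∈p-y x∈q x≢y , x∉p

module OrderedFieldProperties (K : OrderedField) where
  open OrderedField K
  open IsStrictTotalOrder isStrictTotalOrder
    using (compare; irrefl) renaming (trans to <-trans; asym to <-asym)

  commutativeRing : CommutativeRing 0ℓ 0ℓ
  commutativeRing = record { isCommutativeRing = isCommutativeRing }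

  open CommutativeRing commutativeRing
    using (+-comm; +-identityˡ; -‿inverseʳ; *-assoc; *-comm; *-identityʳ; zeroˡ; zeroʳ; ring)
  open RingProperties ring using (-‿involutive; -‿distribˡ-*; -‿distribʳ-*; -1*x≈-x)

  +-monoˡ-< : ∀ {x y} z → x < y → z + x < z + y
  +-monoˡ-< {x} {y} z x<y = subst₂ _<_ (+-comm x z) (+-comm y z) (+-mono-< z x<y)

  x<0⇒0<-x : ∀ {x} → x < 0# → 0# < - x
  x<0⇒0<-x {x} x<0 = subst₂ _<_ (-‿inverseʳ x) (+-identityˡ (- x)) (+-mono-< (- x) x<0)

  0<x⇒-x<0 : ∀ {x} → 0# < x → - x < 0#
  0<x⇒-x<0 {x} 0<x = subst₂ _<_ (+-identityˡ (- x)) (-‿inverseʳ x) (+-mono-< (- x) 0<x)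

  0<-x⇒x<0 : ∀ {x} → 0# < - x → x < 0#
  0<-x⇒x<0 {x} 0<-x = subst (_< 0#) (-‿involutive x) (0<x⇒-x<0 0<-x)

  *-negʳ : ∀ {x y} → 0# < x → y < 0# → x * y < 0#
  *-negʳ {x} {y} 0<x y<0 = 0<-x⇒x<0 (subst (0# <_) (sym (-‿distribʳ-* x y)) (*-pos 0<x (x<0⇒0<-x y<0)))

  0<1 : 0# < 1#
  0<1 with compare 0# 1#
  ... | tri< 0<1′ _ _ = 0<1′
  ... | tri≈ _ 0≡1 _ = ⊥-elim (0≢1 0≡1)
  ... | tri> _ _ 1<0 = ⊥-elim (<-asym 1<0 (subst (0# <_) [-1]*[-1]≡1 (*-pos 0<-1 0<-1)))
    where
    0<-1 : 0# < - 1#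
    0<-1 = x<0⇒0<-x 1<0
    [-1]*[-1]≡1 : - 1# * - 1# ≡ 1#
    [-1]*[-1]≡1 = trans (-1*x≈-x (- 1#)) (-‿involutive 1#)

  0<x⇒x*y≡1⇒0<y : ∀ {x y} → 0# < x → x * y ≡ 1# → 0# < y
  0<x⇒x*y≡1⇒0<y {x} {y} 0<x xy≡1 with compare 0# y
  ... | tri< 0<y _ _ = 0<y
  ... | tri≈ _ 0≡y _ = ⊥-elim (0≢1 (trans (sym (zeroʳ x)) (trans (cong (x *_) 0≡y) xy≡1)))
  ... | tri> _ _ y<0 = ⊥-elim (<-asym 0<1 (subst (_< 0#) xy≡1 (*-negʳ 0<x y<0)))

  -z*y≡1⇒x+x*y*z≡0 : ∀ x {y z} → - z * y ≡ 1# → x + x * y * z ≡ 0#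
  -z*y≡1⇒x+x*y*z≡0 x {y} {z} -zy≡1 = begin
    x + x * y * z     ≡⟨ cong (x +_) (*-assoc x y z) ⟩
    x + x * (y * z)   ≡⟨ cong (λ v → x + x * v) yz≡-1 ⟩
    x + x * - 1#      ≡⟨ cong (x +_) (sym (-‿distribʳ-* x 1#)) ⟩
    x + - (x * 1#)    ≡⟨ cong (λ v → x + - v) (*-identityʳ x) ⟩
    x + - x           ≡⟨ -‿inverseʳ x ⟩
    0#                ∎
    where
    open ≡-Reasoning
    yz≡-1 : y * z ≡ - 1#
    yz≡-1 = begin
      y * z         ≡⟨ *-comm y z ⟩
      z * y         ≡⟨ sym (-‿involutive (z * y)) ⟩
      - - (z * y)   ≡⟨ cong -_ (-‿distribˡ-* z y) ⟩
      - (- z * y)   ≡⟨ cong -_ -zy≡1 ⟩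
      - 1#          ∎

  +-mono-≤ : ∀ {a b c d} → a ≤ b → c ≤ d → (a + c) ≤ (b + d)
  +-mono-≤ (inj₂ refl) (inj₂ refl) = inj₂ refl
  +-mono-≤ {c = c} (inj₁ a<b) (inj₂ refl) = inj₁ (+-mono-< c a<b)
  +-mono-≤ {a = a} (inj₂ refl) (inj₁ c<d) = inj₁ (+-monoˡ-< a c<d)
  +-mono-≤ {b = b} {c = c} (inj₁ a<b) (inj₁ c<d) = inj₁ (<-trans (+-mono-< c a<b) (+-monoˡ-< b c<d))

  data Side : Set where
    pos neg : Side

  opposite : Side → Side
  opposite pos = neg
  opposite neg = pos

  OnSide OnClosedSide : Side → Carrier → Set
  OnSide pos a = 0# < a
  OnSide neg a = a < 0#
  OnClosedSide pos a = 0# ≤ a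
  OnClosedSide neg a = a ≤ 0#

  onSide⇒closedSide : ∀ s {a} → OnSide s a → OnClosedSide s a
  onSide⇒closedSide pos = inj₁
  onSide⇒closedSide neg = inj₁

  ≡0⇒closedSide : ∀ s {a} → a ≡ 0# → OnClosedSide s a
  ≡0⇒closedSide pos a≡0 = inj₂ (sym a≡0)
  ≡0⇒closedSide neg a≡0 = inj₂ a≡0

  onSide⇒≢0 : ∀ s {a} → OnSide s a → a ≢ 0#
  onSide⇒≢0 pos 0<a a≡0 = irrefl (sym a≡0) 0<a
  onSide⇒≢0 neg a<0 a≡0 = irrefl a≡0 a<0

  onSide⇒¬onOpposite : ∀ s {a} → OnSide s a → ¬ OnSide (opposite s) a
  onSide⇒¬onOpposite pos 0<a a<0 = <-asym 0<a a<0
  onSide⇒¬onOpposite neg a<0 0<a = <-asym 0<a a<0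

  ¬onOpposite⇒closedSide : ∀ s {a} → ¬ OnSide (opposite s) a → OnClosedSide s a
  ¬onOpposite⇒closedSide s {a} ¬opp with compare 0# a | s
  ... | tri< 0<a _ _ | pos = inj₁ 0<a
  ... | tri< 0<a _ _ | neg = ⊥-elim (¬opp 0<a)
  ... | tri≈ _ 0≡a _ | s′  = ≡0⇒closedSide s′ (sym 0≡a)
  ... | tri> _ _ a<0 | pos = ⊥-elim (¬opp a<0)
  ... | tri> _ _ a<0 | neg = inj₁ a<0

  closedSide-+ : ∀ s {a b} → OnClosedSide s a → OnClosedSide s b → OnClosedSide s (a + b)
  closedSide-+ pos {a} {b} 0≤a 0≤b = subst (_≤ (a + b)) (+-identityˡ 0#) (+-mono-≤ 0≤a 0≤b)
  closedSide-+ neg {a} {b} a≤0 b≤0 = subst ((a + b) ≤_) (+-identityˡ 0#) (+-mono-≤ a≤0 b≤0)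

  closedSide-* : ∀ s {c d} → 0# ≤ c → OnClosedSide s d → OnClosedSide s (c * d)
  closedSide-* s {d = d} (inj₂ refl) _ = ≡0⇒closedSide s (zeroˡ d)
  closedSide-* pos {c} (inj₁ _) (inj₂ refl) = ≡0⇒closedSide pos (zeroʳ c)
  closedSide-* neg {c} (inj₁ _) (inj₂ refl) = ≡0⇒closedSide neg (zeroʳ c)
  closedSide-* pos (inj₁ 0<c) (inj₁ 0<d) = inj₁ (*-pos 0<c 0<d)
  closedSide-* neg (inj₁ 0<c) (inj₁ d<0) = inj₁ (*-negʳ 0<c d<0)

module GeometryProperties (K : OrderedField) (r N : ℕ) (φ : Fin N → Fin r → OrderedField.Carrier K) where
  open OrderedField K
  open Geometry K r N φ
  open OrderedFieldProperties K
  open IsStrictTotalOrder isStrictTotalOrder using (_<?_)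
  open CommutativeRing commutativeRing
    using (+-commutativeSemigroup; *-commutativeSemigroup; +-identityʳ; *-assoc; zeroˡ; zeroʳ
          ; distribˡ; distribʳ; ring; semiring)
  open RingProperties ring using (//-rightDividesˡ; //-rightDividesʳ)
  open CommutativeSemigroupProperties +-commutativeSemigroup using (xy∙z≈xz∙y)
  open CommutativeSemigroupProperties *-commutativeSemigroup using (x∙yz≈y∙xz)
  open SemiringSum semiring using (sum; sum-cong-≗; ∑-distrib-+; ∑-comm; *-distribˡ-sum)
  open ≡-Reasoning

  sumF≡sum : ∀ {n} (f : Fin n → Carrier) → sumF f ≡ sum f
  sumF≡sum {ℕ.zero}  f = refl
  sumF≡sum {ℕ.suc n} f = cong (f zero +_) (sumF≡sum (λ i → f (suc i)))

  sumF-cong : ∀ {n} {f g : Fin n → Carrier} → (∀ i → f i ≡ g i) → sumF f ≡ sumF g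
  sumF-cong {f = f} {g} f≗g = trans (sumF≡sum f) (trans (sum-cong-≗ f≗g) (sym (sumF≡sum g)))

  sumF-distrib-+ : ∀ {n} (f g : Fin n → Carrier) → sumF (λ i → f i + g i) ≡ sumF f + sumF g
  sumF-distrib-+ f g =
    trans (sumF≡sum (λ i → f i + g i)) (trans (∑-distrib-+ f g) (sym (cong₂ _+_ (sumF≡sum f) (sumF≡sum g))))

  *-distribˡ-sumF : ∀ {n} x (f : Fin n → Carrier) → x * sumF f ≡ sumF (λ i → x * f i)
  *-distribˡ-sumF x f =
    trans (cong (x *_) (sumF≡sum f)) (trans (*-distribˡ-sum x f) (sym (sumF≡sum (λ i → x * f i))))

  sumF²≡sum² : ∀ {m n} (f : Fin m → Fin n → Carrier) →
               sumF (λ i → sumF (f i)) ≡ sum (λ i → sum (f i))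
  sumF²≡sum² f = trans (sumF≡sum (λ i → sumF (f i))) (sum-cong-≗ (λ i → sumF≡sum (f i)))

  sumF-comm : ∀ {m n} (f : Fin m → Fin n → Carrier) →
              sumF (λ i → sumF (f i)) ≡ sumF (λ j → sumF (λ i → f i j))
  sumF-comm f = trans (sumF²≡sum² f) (trans (∑-comm f) (sym (sumF²≡sum² (flip f))))

  sumF-closed : (P : Carrier → Set) → P 0# → (∀ {a b} → P a → P b → P (a + b)) →
                ∀ {n} (f : Fin n → Carrier) → (∀ i → P (f i)) → P (sumF f)
  sumF-closed P P0 P+ {ℕ.zero}  f Pf = P0
  sumF-closed P P0 P+ {ℕ.suc n} f Pf = P+ (Pf zero) (sumF-closed P P0 P+ (λ i → f (suc i)) (λ i → Pf (suc i)))

  infixl 6 _+v_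
  infixr 7 _·v_

  _+v_ : Vect → Vect → Vect
  (x +v y) j = x j + y j

  _·v_ : Carrier → Vect → Vect
  (t ·v x) j = t * x j

  dot-congʳ : ∀ w {x y} → x ≈v y → dot w x ≡ dot w y
  dot-congʳ w x≈y = sumF-cong (λ j → cong (w j *_) (x≈y j))

  dot-+v : ∀ w x y → dot w (x +v y) ≡ dot w x + dot w y
  dot-+v w x y =
    trans (sumF-cong (λ j → distribˡ (w j) (x j) (y j))) (sumF-distrib-+ (λ j → w j * x j) (λ j → w j * y j))

  dot-·v : ∀ w t x → dot w (t ·v x) ≡ t * dot w x
  dot-·v w t x = trans (sumF-cong (λ j → x∙yz≈y∙xz (w j) t (x j))) (sym (*-distribˡ-sumF t (λ j → w j * x j)))

  dot-comb : ∀ w c → dot w (comb c) ≡ sumF (λ i → c i * dot w (φ i))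
  dot-comb w c = begin
    sumF (λ j → w j * sumF (λ i → c i * φ i j))
      ≡⟨ sumF-cong (λ j → *-distribˡ-sumF (w j) (λ i → c i * φ i j)) ⟩
    sumF (λ j → sumF (λ i → w j * (c i * φ i j)))
      ≡⟨ sumF-comm (λ j i → w j * (c i * φ i j)) ⟩
    sumF (λ i → sumF (λ j → w j * (c i * φ i j)))
      ≡⟨ sumF-cong (λ i → sumF-cong (λ j → x∙yz≈y∙xz (w j) (c i) (φ i j))) ⟩
    sumF (λ i → sumF (λ j → c i * (w j * φ i j)))
      ≡⟨ sumF-cong (λ i → sym (*-distribˡ-sumF (c i) (λ j → w j * φ i j))) ⟩
    sumF (λ i → c i * dot w (φ i))
      ∎

  comb-+ : ∀ c d → comb (λ i → c i + d i) ≈v (comb c +v comb d)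
  comb-+ c d j = trans (sumF-cong (λ i → distribʳ (φ i j) (c i) (d i)))
                       (sumF-distrib-+ (λ i → c i * φ i j) (λ i → d i * φ i j))

  comb-· : ∀ t c → comb (λ i → t * c i) ≈v (t ·v comb c)
  comb-· t c j = trans (sumF-cong (λ i → *-assoc t (c i) (φ i j)))
                       (sym (*-distribˡ-sumF t (λ i → c i * φ i j)))

  InCone-cong : ∀ {σ x y} → x ≈v y → InCone σ x → InCone σ y
  InCone-cong x≈y (c , c-supp , c≥0 , c≈x) = c , c-supp , c≥0 , λ j → trans (c≈x j) (x≈y j)

  InCone-+ : ∀ {σ x y} → InCone σ x → InCone σ y → InCone σ (x +v y)
  InCone-+ (c , c-supp , c≥0 , c≈x) (d , d-supp , d≥0 , d≈y) =
    (λ i → c i + d i) ,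
    (λ i i∉σ → trans (cong₂ _+_ (c-supp i i∉σ) (d-supp i i∉σ)) (+-identityʳ 0#)) ,
    (λ i i∈σ → closedSide-+ pos (c≥0 i i∈σ) (d≥0 i i∈σ)) ,
    (λ j → trans (comb-+ c d j) (cong₂ _+_ (c≈x j) (d≈y j)))

  InCone-· : ∀ {σ x t} → 0# ≤ t → InCone σ x → InCone σ (t ·v x)
  InCone-· {t = t} t≥0 (c , c-supp , c≥0 , c≈x) =
    (λ i → t * c i) ,
    (λ i i∉σ → trans (cong (t *_) (c-supp i i∉σ)) (zeroʳ t)) ,
    (λ i i∈σ → closedSide-* pos t≥0 (c≥0 i i∈σ)) ,
    (λ j → trans (comb-· t c j) (cong (t *_) (c≈x j)))

  InCone⇒closedSide : ∀ s w {σ x} → (∀ i → i ∈ σ → OnClosedSide s (dot w (φ i))) →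
                      InCone σ x → OnClosedSide s (dot w x)
  InCone⇒closedSide s w {σ} generators-on-side (c , c-supp , c≥0 , c≈x) =
    subst (OnClosedSide s) (trans (sym (dot-comb w c)) (dot-congʳ w c≈x))
      (sumF-closed (OnClosedSide s) (≡0⇒closedSide s refl) (closedSide-+ s)
                   (λ i → c i * dot w (φ i)) term-on-side)
    where
    term-on-side : ∀ i → OnClosedSide s (c i * dot w (φ i))
    term-on-side i with i ∈? σ
    ... | yes i∈σ = closedSide-* s (c≥0 i i∈σ) (generators-on-side i i∈σ)
    ... | no  i∉σ = ≡0⇒closedSide s (trans (cong (_* dot w (φ i)) (c-supp i i∉σ)) (zeroˡ (dot w (φ i))))

  Interior⊆ : ∀ {S : Vect → Set} {x} → Interior S x → S x
  Interior⊆ {x = x} (ε , 0<ε , ball⊆S) = ball⊆S x λ j →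
    subst (x j - ε <_) (+-identityʳ (x j)) (+-monoˡ-< (x j) (0<x⇒-x<0 0<ε)) ,
    subst (_< x j + ε) (+-identityʳ (x j)) (+-monoˡ-< (x j) 0<ε)

  Interior-mono : ∀ {S T : Vect → Set} {x} → (∀ v → S v → T v) → Interior S x → Interior T x
  Interior-mono S⊆T (ε , 0<ε , ball⊆S) = ε , 0<ε , λ v v∈ball → S⊆T v (ball⊆S v v∈ball)

  Interior-translate : ∀ {S : Vect → Set} {p} s → (∀ v → S (v +v -v s) → S v) →
                       Interior S p → Interior S (p +v s)
  Interior-translate {p = p} s S-translate (ε , 0<ε , ball⊆S) = ε , 0<ε , λ v v∈ball →
    S-translate v (ball⊆S (v +v -v s) λ j →
      subst (_< v j - s j) (shift (p j) (s j) (- ε)) (+-mono-< (- s j) (proj₁ (v∈ball j))) ,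
      subst (v j - s j <_) (shift (p j) (s j) ε) (+-mono-< (- s j) (proj₂ (v∈ball j))))
    where
    shift : ∀ a b e → (a + b + e) - b ≡ a + e
    shift a b e = trans (cong (_- b) (xy∙z≈xz∙y a b e)) (//-rightDividesʳ b (a + e))

  Interior-InCone-+ : ∀ {σ p s} → Interior (InCone σ) p → InCone σ s → Interior (InCone σ) (p +v s)
  Interior-InCone-+ {s = s} p∈intC s∈C =
    Interior-translate s
      (λ v v-s∈C → InCone-cong (λ j → //-rightDividesˡ (s j) (v j)) (InCone-+ v-s∈C s∈C)) p∈intC

  InteriorOfAll : SetOfSubsets → Vect → Set
  InteriorOfAll P x = ∀ σ → P σ → Interior (InCone σ) x

  WallPoint : Vect → SetOfSubsets → Set
  WallPoint w P = ∃[ z ] ((dot w z ≡ 0#) × InteriorOfAll P z)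

  -- The witness is p + t q with t = (w·p) / (- w·q).
  nonneg∧nonpos⇒WallPoint : ∀ w P {p q} → InteriorOfAll P p → InteriorOfAll P q →
                            0# ≤ dot w p → dot w q ≤ 0# → WallPoint w P
  nonneg∧nonpos⇒WallPoint w P {q = q} _ q∈int _ (inj₂ w·q≡0) = q , w·q≡0 , q∈int
  nonneg∧nonpos⇒WallPoint w P {p} {q} p∈int q∈int w·p≥0 (inj₁ w·q<0) = p +v t ·v q , on-wall , z∈int
    where
    0<-w·q : 0# < - dot w q
    0<-w·q = x<0⇒0<-x w·q<0
    u : Carrier
    u = proj₁ (inverse (- dot w q) (onSide⇒≢0 pos 0<-w·q))
    -w·q*u≡1 : - dot w q * u ≡ 1#
    -w·q*u≡1 = proj₂ (inverse (- dot w q) (onSide⇒≢0 pos 0<-w·q))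
    t : Carrier
    t = dot w p * u
    t≥0 : 0# ≤ t
    t≥0 = closedSide-* pos w·p≥0 (inj₁ (0<x⇒x*y≡1⇒0<y 0<-w·q -w·q*u≡1))
    on-wall : dot w (p +v t ·v q) ≡ 0#
    on-wall = begin
      dot w (p +v t ·v q)        ≡⟨ dot-+v w p (t ·v q) ⟩
      dot w p + dot w (t ·v q)   ≡⟨ cong (dot w p +_) (dot-·v w t q) ⟩
      dot w p + t * dot w q      ≡⟨ -z*y≡1⇒x+x*y*z≡0 (dot w p) -w·q*u≡1 ⟩
      0#                         ∎
    z∈int : InteriorOfAll P (p +v t ·v q)
    z∈int σ Pσ = Interior-InCone-+ (p∈int σ Pσ) (InCone-· t≥0 (Interior⊆ (q∈int σ Pσ)))

  opposite-sides⇒WallPoint : ∀ s w P {p q} → InteriorOfAll P p → InteriorOfAll P q →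
                             OnClosedSide s (dot w p) → OnClosedSide (opposite s) (dot w q) → WallPoint w P
  opposite-sides⇒WallPoint pos w P p∈int q∈int = nonneg∧nonpos⇒WallPoint w P p∈int q∈int
  opposite-sides⇒WallPoint neg w P p∈int q∈int p-side q-side =
    nonneg∧nonpos⇒WallPoint w P q∈int p∈int q-side p-side

  δ : Side → Vect → Subset N → SetOfSubsets
  δ s w ν σ = ∃[ i ] (OnSide s (dot w (φ i)) × σ ≡ ν ∪ ⁅ i ⁆)

  δ∩I=∅⇒δ⊆reflexion : ∀ s {I w ν σ} → BW I w ν → Disjoint (δ s w ν) I → δ s w ν σ → reflexion I w σ
  δ∩I=∅⇒δ⊆reflexion pos ν∈B δ∩I=∅ σ∈δ = inj₂ (_ , ν∈B , inj₁ (σ∈δ , δ∩I=∅))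
  δ∩I=∅⇒δ⊆reflexion neg ν∈B δ∩I=∅ σ∈δ = inj₂ (_ , ν∈B , inj₂ (σ∈δ , δ∩I=∅))

  Cut⇒OnSide : ∀ s {I w σ} → Cut I w σ → ∃[ k ] (k ∈ σ × OnSide s (dot w (φ k)))
  Cut⇒OnSide pos (_ , k-pos , _) = k-pos
  Cut⇒OnSide neg (_ , _ , k-neg) = k-neg

  δ-generators-closedSide : ∀ s w {τ ρ} → (∀ i → i ∈ τ → Zero w i) → δ s w τ ρ →
                            ∀ i → i ∈ ρ → OnClosedSide s (dot w (φ i))
  δ-generators-closedSide s w {τ} τ-on-wall (k , k-side , refl) i i∈ρ with x∈p∪q⁻ τ ⁅ k ⁆ i∈ρ
  ... | inj₁ i∈τ   = ≡0⇒closedSide s (τ-on-wall i i∈τ)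
  ... | inj₂ i∈⁅k⁆ =
    subst (λ m → OnClosedSide s (dot w (φ m))) (sym (x∈⁅y⁆⇒x≡y k i∈⁅k⁆)) (onSide⇒closedSide s k-side)

  facet-unmixed : ∀ s w {σ τ i j} → ∣ σ ∣ ≡ r → IsZeroPart w σ τ → ∣ τ ∣ ≡ r ℕ.∸ 1 → i ∈ σ → j ∈ σ →
                  OnSide s (dot w (φ i)) → ¬ OnSide (opposite s) (dot w (φ j))
  facet-unmixed s w {σ} {τ} {i} {j} ∣σ∣≡r τ=σ∩W ∣τ∣≡r-1 i∈σ j∈σ i-side j-side =
    2+[r∸1]≰r (subst₂ (λ a b → ℕ.suc (ℕ.suc a) ℕ.≤ b) ∣τ∣≡r-1 ∣σ∣≡r
      (two∈q∖p⇒2+∣p∣≤∣q∣ τ⊆σ i∈σ j∈σ i≢j (off-wall s i-side) (off-wall (opposite s) j-side)))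
    where
    τ⊆σ : τ ⊆ σ
    τ⊆σ {k} k∈τ = proj₁ (Equivalence.to (τ=σ∩W k) k∈τ)
    off-wall : ∀ s′ {k} → OnSide s′ (dot w (φ k)) → k ∉ τ
    off-wall s′ {k} k-side k∈τ = onSide⇒≢0 s′ k-side (proj₂ (Equivalence.to (τ=σ∩W k) k∈τ))
    i≢j : i ≢ j
    i≢j refl = onSide⇒¬onOpposite s i-side j-side
    2+[r∸1]≰r : ¬ (ℕ.suc (ℕ.suc (r ℕ.∸ 1)) ℕ.≤ r)
    2+[r∸1]≰r 2+[r∸1]≤r = <-irrefl refl (≤-trans 2+[r∸1]≤r (m≤n+m∸n r 1))

  facet-side : ∀ w {σ τ} → ∣ σ ∣ ≡ r → IsZeroPart w σ τ → ∣ τ ∣ ≡ r ℕ.∸ 1 →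
               ∃[ s ] (∀ i → i ∈ σ → OnClosedSide s (dot w (φ i)))
  facet-side w {σ} ∣σ∣≡r τ=σ∩W ∣τ∣≡r-1 with any? (λ i → i ∈? σ ×-dec 0# <? dot w (φ i))
  ... | yes (i , i∈σ , i-pos) =
    pos , λ j j∈σ → ¬onOpposite⇒closedSide pos (facet-unmixed pos w ∣σ∣≡r τ=σ∩W ∣τ∣≡r-1 i∈σ j∈σ i-pos)
  ... | no ∄pos = neg , λ j j∈σ → ¬onOpposite⇒closedSide neg (λ j-pos → ∄pos (j , j∈σ , j-pos))

  reflexion-infeasible : ∀ {I w} → InB I → Feasible I → Cond2 I w → NotCond4 I w → ¬ Feasible (reflexion I w)
  reflexion-infeasible {I} {w} I⊆𝓑 (x , x∈intF) (σ , facet@(Iσ , τ , τ=σ∩W , ∣τ∣≡r-1))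
                       ((σ′ , cut) , ¬wall-point) (y , y∈intF) =
    ¬wall-point (opposite-sides⇒WallPoint s w (Cut I w) x∈intCut y∈intCut x-side y-side)
    where
    x∈F : F I x
    x∈F = Interior⊆ x∈intF
    x∈intCut : InteriorOfAll (Cut I w) x
    x∈intCut ρ ρ∈Cut = Interior-mono (λ v v∈F → v∈F ρ (proj₁ ρ∈Cut)) x∈intF
    y∈intCut : InteriorOfAll (Cut I w) y
    y∈intCut ρ ρ∈Cut = Interior-mono (λ v v∈F → v∈F ρ (inj₁ ρ∈Cut)) y∈intF
    side : ∃[ s ] (∀ i → i ∈ σ → OnClosedSide s (dot w (φ i)))
    side = facet-side w (proj₁ (I⊆𝓑 σ Iσ)) τ=σ∩W ∣τ∣≡r-1
    s : Side
    s = proj₁ side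
    x-side : OnClosedSide s (dot w x)
    x-side = InCone⇒closedSide s w (proj₂ side) (x∈F σ Iσ)
    δ-cone-side : ∀ {ρ v} → δ (opposite s) w τ ρ → InCone ρ v → OnClosedSide (opposite s) (dot w v)
    δ-cone-side = InCone⇒closedSide (opposite s) w ∘ δ-generators-closedSide (opposite s) w
                    (λ i i∈τ → proj₂ (Equivalence.to (τ=σ∩W i) i∈τ))
    δ∩I=∅ : Disjoint (δ (opposite s) w τ) I
    δ∩I=∅ (ρ , ρ∈δ , Iρ) =
      ¬wall-point (opposite-sides⇒WallPoint s w (Cut I w) x∈intCut x∈intCut
                                              x-side (δ-cone-side ρ∈δ (x∈F ρ Iρ)))
    cut-generator : ∃[ k ] (k ∈ σ′ × OnSide (opposite s) (dot w (φ k)))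
    cut-generator = Cut⇒OnSide (opposite s) {I} cut
    k : Fin N
    k = proj₁ cut-generator
    τ+k∈δ : δ (opposite s) w τ (τ ∪ ⁅ k ⁆)
    τ+k∈δ = k , proj₂ (proj₂ cut-generator) , refl
    y-side : OnClosedSide (opposite s) (dot w y)
    y-side = δ-cone-side τ+k∈δ
      (Interior⊆ y∈intF (τ ∪ ⁅ k ⁆) (δ∩I=∅⇒δ⊆reflexion (opposite s) (σ , facet , τ=σ∩W) δ∩I=∅ τ+k∈δ))

-- Only the feasibility of I, condition (2) and the failure of (4) are used.
mainTheorem12 : (K : OrderedField) (r N : ℕ) (φ : Fin N → Fin r → OrderedField.Carrier K) →
    Geometry.Distinct K r N φ → Geometry.NonzeroVectors K r N φ →
    Geometry.Spanning K r N φ → Geometry.Pointed K r N φ →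
    (I : Geometry.SetOfSubsets K r N φ) → Geometry.Chamber K r N φ I →
    (w : Geometry.Vect K r N φ) → Geometry.IsWall K r N φ w →
    Geometry.Cond1 K r N φ I w → Geometry.Cond2 K r N φ I w →
    Geometry.Cond3 K r N φ I w → Geometry.NotCond4 K r N φ I w →
    ¬ Geometry.Feasible K r N φ (Geometry.reflexion K r N φ I w)
mainTheorem12 K r N φ _ _ _ _ I (I⊆𝓑 , I-feasible , _) w _ _ cond2 _ ¬cond4 =
  GeometryProperties.reflexion-infeasible K r N φ I⊆𝓑 I-feasible cond2 ¬cond4
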